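{- Let $a<b$ be coprime positive integers and $k\ge 0$. In the process producing $\xi_{k+1}$ from $\xi_k$ (adding $b$ chips to vertex $1$ and settling), vertex $1$ fires exactly $0$ times if $\xi_k$ is dormant and exactly once if $\xi_k$ is not dormant.
   Context: Settlements for the $a$-$b$ chip-firing game: configurations of chips on vertices $1,2,3,\dots$ of $\mathbb{Z}$, written $.s_1s_2\ldots s_\ell$ where $s_i$ is the number of chips at vertex $i$. Let $\xi_0$ be the empty configuration. Given $\xi_k$, obtain $\xi_{k+1}$ by adding $b$ chips to vertex $1$ and then repeatedly firing any vertex $i\ge 1$ that has at least $a+b$ chips: it loses $a+b$ chips, vertex $i+1$ gains $b$, vertex $i-1$ gains $a$ if $i-1\ge1$ (chips sent to vertex $0$ are discarded), until no vertex $i\ge1$ has at least $a+b$ chips. A settlement is dormant if its number of chips at vertex $1$ is less than $a$. -}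

module Defs where

open import Data.Nat using (ℕ; zero; suc; _+_; _∸_; _≤_; _<_; _≟_; _≤?_)
open import Data.List using (List; []; _∷_)
open import Data.Bool using (if_then_else_)
open import Relation.Nullary using (Dec; yes; no)
open import Relation.Nullary.Decidable using (⌊_⌋)
open import Relation.Binary.PropositionalEquality using (_≡_)

-- A configuration assigns a chip count to each vertex i ≥ 1.
-- Index 0 is never used (chips sent to vertex 0 are discarded),
-- so c 0 is irrelevant; all configurations arising here have c 0 = 0.
Config : Set
Config = ℕ → ℕ

empty : Config
empty _ = 0

addAt1 : ℕ → Config → Config
addAt1 b c j with j ≟ 1
... | yes _ = c j + b
... | no  _ = c j

[_]· : {P : Set} → Dec P → ℕ → ℕ
[ yes _ ]· n = n
[ no  _ ]· n = 0

-- firing vertex i (i ≥ 1) in the a-b game: i loses a+b, i+1 gains b,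
-- i-1 gains a provided i-1 ≥ 1 (chips to vertex 0 discarded)
fire : ℕ → ℕ → ℕ → Config → Config
fire a b i c j with j ≟ i
... | yes _ = c j ∸ (a + b)
... | no  _ = c j + [ j ≟ suc i ]· b + [ 1 ≤? j ]· ([ suc j ≟ i ]· a)

Stable : ℕ → ℕ → Config → Set
Stable a b c = ∀ i → 1 ≤ i → c i < a + b

data Fires (a b : ℕ) : Config → List ℕ → Config → Set where
  done : ∀ c → Fires a b c [] c
  step : ∀ {c c'} i is → 1 ≤ i → a + b ≤ c i →
         Fires a b (fire a b i c) is c' → Fires a b c (i ∷ is) c'

Settling : ℕ → ℕ → Config → List ℕ → Config → Set
Settling a b c is c' = Fires a b c is c' × Stable a b c'
  where open import Data.Product using (_×_)

data Xi (a b : ℕ) : ℕ → Config → Set where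
  xi0 : Xi a b 0 empty
  xiS : ∀ {k ξ is ξ'} → Xi a b k ξ → Settling a b (addAt1 b ξ) is ξ' →
        Xi a b (suc k) ξ'

firesOf1 : List ℕ → ℕ
firesOf1 [] = 0
firesOf1 (i ∷ is) with i ≟ 1
... | yes _ = suc (firesOf1 is)
... | no  _ = firesOf1 is

Dormant : ℕ → Config → Set
Dormant a ξ = ξ 1 < a

-- ξ is stable, so after adding b chips only vertex 1 can be unstable, and it
-- is unstable exactly when ξ is not dormant. Firing it leaves fewer than b chips
-- there and makes vertex 2 the only candidate. Inductively, the only unstable
-- vertex is the right neighbour of the last fired one, which itself now holds
-- fewer than b chips and so stays stable when it receives a. Hence the firing
-- sequence is forced to be 1, 2, 3, …, and vertex 1 fires at most once.
module Submission where

open import Defs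
open import Data.Nat using (ℕ; _<_; suc)
open import Data.Nat.Coprimality using (Coprime)
open import Data.List using (List)
open import Relation.Nullary using (¬_)
open import Relation.Binary.PropositionalEquality using (_≡_)
open import Data.Product using (_×_)

open import Data.Nat using (zero; _+_; _∸_; _≤_; _≟_; _≤?_; z≤n; s≤s; >-nonZero)
open import Data.Nat.Properties
open import Data.List using ([]; _∷_; length)
open import Data.Product using (_,_)
open import Relation.Nullary using (Dec; yes; no; contradiction)
open import Relation.Binary.PropositionalEquality using (_≢_; ≢-sym; refl; cong; module ≡-Reasoning)

[]·-yes : {P : Set} (d : Dec P) (n : ℕ) → P → [ d ]· n ≡ n
[]·-yes (yes _) n p = refl
[]·-yes (no ¬p) n p = contradiction p ¬p

[]·-no : {P : Set} (d : Dec P) (n : ℕ) → ¬ P → [ d ]· n ≡ 0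
[]·-no (yes p) n ¬p = contradiction p ¬p
[]·-no (no _) n ¬p = refl

[]·-zero : {P : Set} (d : Dec P) → [ d ]· 0 ≡ 0
[]·-zero (yes _) = refl
[]·-zero (no _) = refl

fire-self : ∀ a b i c → fire a b i c i ≡ c i ∸ (a + b)
fire-self a b i c rewrite ≟-diag (refl {x = i}) = refl

fire-off : ∀ a b i c j → j ≢ i →
  fire a b i c j ≡ c j + [ j ≟ suc i ]· b + [ 1 ≤? j ]· ([ suc j ≟ i ]· a)
fire-off a b i c j j≢i with j ≟ i
... | yes j≡i = contradiction j≡i j≢i
... | no _ = refl

fire-next : ∀ a b i c → fire a b i c (suc i) ≡ c (suc i) + b
fire-next a b i c
  rewrite fire-off a b i c (suc i) (1+n≢n {i})
        | []·-yes (suc i ≟ suc i) b refl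
        | []·-no (suc (suc i) ≟ i) a (≢-sym (m≢1+n+m i))
        | []·-zero (1 ≤? suc i)
        | +-identityʳ (c (suc i) + b) = refl

fire-prev : ∀ a b j i c → suc j ≡ i → 1 ≤ j → fire a b i c j ≡ c j + a
fire-prev a b j .(suc j) c refl 1≤j
  rewrite fire-off a b (suc j) c j (≢-sym 1+n≢n)
        | []·-no (j ≟ suc (suc j)) b (m≢1+n+m j)
        | []·-yes (suc j ≟ suc j) a refl
        | []·-yes (1 ≤? j) a 1≤j
        | +-identityʳ (c j) = refl

fire-far : ∀ a b i c j → j ≢ i → j ≢ suc i → suc j ≢ i → fire a b i c j ≡ c j
fire-far a b i c j j≢i j≢1+i 1+j≢i
  rewrite fire-off a b i c j j≢i
        | []·-no (j ≟ suc i) b j≢1+i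
        | []·-no (suc j ≟ i) a 1+j≢i
        | []·-zero (1 ≤? j)
        | +-identityʳ (c j) = +-identityʳ (c j)

-- A wave at h: only vertex h may be unstable, it is short of firing twice,
-- and its left neighbour can absorb the a chips that firing h sends back.
record Wave (a b h : ℕ) (d : Config) : Set where
  field
    others : ∀ i → 1 ≤ i → i ≢ h → d i < a + b
    hot : d h < a + b + b
    trailing : ∀ j → 1 ≤ j → suc j ≡ h → d j < b

open Wave

fireable-is-hot : ∀ {a b h d i} → Wave a b h d → 1 ≤ i → a + b ≤ d i → i ≡ h
fireable-is-hot {h = h} {i = i} w 1≤i a+b≤di with i ≟ h
... | yes i≡h = i≡h
... | no i≢h = contradiction a+b≤di (<⇒≱ (others w i 1≤i i≢h))

wave-stable : ∀ {a b h d} → Wave a b h d → d h < a + b → Stable a b d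
wave-stable {h = h} w dh<a+b i 1≤i with i ≟ h
... | yes refl = dh<a+b
... | no i≢h = others w i 1≤i i≢h

wave-step : ∀ {a b h d} → 0 < b → Wave a b h d → Wave a b (suc h) (fire a b h d)
wave-step {a} {b} {h} {d} 0<b w = record
  { others = others′ ; hot = hot′ ; trailing = trailing′ }
  where
  emptied-at : ∀ i → i ≡ h → fire a b h d i < b
  emptied-at i refl rewrite fire-self a b h d =
    m<n+o⇒m∸n<o (d h) (a + b) {{>-nonZero 0<b}} (hot w)
  others′ : ∀ i → 1 ≤ i → i ≢ suc h → fire a b h d i < a + b
  others′ i 1≤i i≢1+h = by-position (i ≟ h) (suc i ≟ h)
    where
    by-position : Dec (i ≡ h) → Dec (suc i ≡ h) → fire a b h d i < a + b
    by-position (yes i≡h) _ = <-≤-trans (emptied-at i i≡h) (m≤n+m b a)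
    by-position (no _) (yes 1+i≡h) rewrite fire-prev a b i h d 1+i≡h 1≤i =
      <-≤-trans (+-monoˡ-< a (trailing w i 1≤i 1+i≡h)) (≤-reflexive (+-comm b a))
    by-position (no i≢h) (no 1+i≢h) rewrite fire-far a b h d i i≢h i≢1+h 1+i≢h =
      others w i 1≤i i≢h
  hot′ : fire a b h d (suc h) < a + b + b
  hot′ rewrite fire-next a b h d = +-monoˡ-< b (others w (suc h) (s≤s z≤n) 1+n≢n)
  trailing′ : ∀ j → 1 ≤ j → suc j ≡ suc h → fire a b h d j < b
  trailing′ j _ 1+j≡1+h = emptied-at j (suc-injective 1+j≡1+h)

consecutive : ℕ → ℕ → List ℕ
consecutive h zero = []
consecutive h (suc n) = h ∷ consecutive (suc h) n

wave-fires-consecutive : ∀ {a b h d is d′} → 0 < b → Wave a b h d → Fires a b d is d′ →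
  is ≡ consecutive h (length is)
wave-fires-consecutive 0<b w (done _) = refl
wave-fires-consecutive 0<b w (step i is 1≤i a+b≤di f) with fireable-is-hot w 1≤i a+b≤di
... | refl = cong (i ∷_) (wave-fires-consecutive 0<b (wave-step 0<b w) f)

firesOf1-consecutive : ∀ h n → 1 < h → firesOf1 (consecutive h n) ≡ 0
firesOf1-consecutive h zero 1<h = refl
firesOf1-consecutive h (suc n) 1<h with h ≟ 1
... | yes h≡1 = contradiction h≡1 (>⇒≢ 1<h)
... | no _ = firesOf1-consecutive (suc h) n (m<n⇒m<1+n 1<h)

stable-fires-nothing : ∀ {a b d is d′} → Stable a b d → Fires a b d is d′ → is ≡ []
stable-fires-nothing st (done _) = refl
stable-fires-nothing st (step i is 1≤i a+b≤di f) = contradiction a+b≤di (<⇒≱ (st i 1≤i))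

wave-at-1-fires-1-once : ∀ {a b d is d′} → 0 < b → Wave a b 1 d → a + b ≤ d 1 →
  Settling a b d is d′ → firesOf1 is ≡ 1
wave-at-1-fires-1-once 0<b w a+b≤d1 (done _ , st) = contradiction a+b≤d1 (<⇒≱ (st 1 (s≤s z≤n)))
wave-at-1-fires-1-once 0<b w a+b≤d1 (step i is 1≤i a+b≤di f , _)
  with fireable-is-hot w 1≤i a+b≤di
... | refl = cong suc (begin
  firesOf1 is                          ≡⟨ cong firesOf1 (wave-fires-consecutive 0<b (wave-step 0<b w) f) ⟩
  firesOf1 (consecutive 2 (length is)) ≡⟨ firesOf1-consecutive 2 (length is) (s≤s (s≤s z≤n)) ⟩
  0                                    ∎)
  where open ≡-Reasoning

addAt1-off : ∀ b c j → j ≢ 1 → addAt1 b c j ≡ c j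
addAt1-off b c j j≢1 with j ≟ 1
... | yes j≡1 = contradiction j≡1 j≢1
... | no _ = refl

addAt1-wave : ∀ {a b ξ} → Stable a b ξ → Wave a b 1 (addAt1 b ξ)
addAt1-wave {a} {b} {ξ} st = record
  { others = others′ ; hot = +-monoˡ-< b (st 1 (s≤s z≤n)) ; trailing = trailing′ }
  where
  others′ : ∀ i → 1 ≤ i → i ≢ 1 → addAt1 b ξ i < a + b
  others′ i 1≤i i≢1 rewrite addAt1-off b ξ i i≢1 = st i 1≤i
  trailing′ : ∀ j → 1 ≤ j → suc j ≡ 1 → addAt1 b ξ j < b
  trailing′ (suc j) _ ()

xi-stable : ∀ {a b k ξ} → 0 < a + b → Xi a b k ξ → Stable a b ξ
xi-stable 0<a+b xi0 _ _ = 0<a+b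
xi-stable 0<a+b (xiS _ (_ , st)) = st

mainTheorem12 : ∀ (a b : ℕ) → 0 < a → a < b → Coprime a b →
    ∀ (k : ℕ) (ξ : Config) → Xi a b k ξ →
    ∀ (is : List ℕ) (ξ' : Config) → Settling a b (addAt1 b ξ) is ξ' →
      (Dormant a ξ → firesOf1 is ≡ 0) × (¬ Dormant a ξ → firesOf1 is ≡ 1)
mainTheorem12 a b 0<a a<b _ k ξ xi is ξ' settling@(fires , _) = dormant , awake
  where
  wave : Wave a b 1 (addAt1 b ξ)
  wave = addAt1-wave (xi-stable (<-≤-trans 0<a (m≤m+n a b)) xi)
  dormant : Dormant a ξ → firesOf1 is ≡ 0
  dormant ξ1<a = cong firesOf1 (stable-fires-nothing (wave-stable wave (+-monoˡ-< b ξ1<a)) fires)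
  awake : ¬ Dormant a ξ → firesOf1 is ≡ 1
  awake ¬dormant =
    wave-at-1-fires-1-once (<-trans 0<a a<b) wave (+-monoˡ-≤ b (≮⇒≥ ¬dormant)) settling
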